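{- For any pair of integers $a,b$ with $1\le a\le b\le 2a$, there exist a connected graph $G$ with $\gamma(G)=a$ and a function $f:V(G_1)\to V(G_2)$ such that $\gamma(C(G,f))=b$.
   Context: For disjoint copies $G_1,G_2$ of a graph $G$ and a function $f:V(G_1)\to V(G_2)$, the functigraph $C(G,f)$ has vertex set $V(G_1)\cup V(G_2)$ and edge set $E(G_1)\cup E(G_2)\cup\{uv : u\in V(G_1), v\in V(G_2), v=f(u)\}$. $\gamma(H)$ denotes the domination number of a graph $H$. -}

module Defs where

open import Data.Nat using (ℕ; zero; suc; _+_; _≤_)
open import Data.Fin using (Fin; splitAt)
import Data.Fin as Fin
open import Relation.Nullary.Decidable using (⌊_⌋)
open import Data.Fin.Subset using (Subset; _∈_; ∣_∣)
open import Data.Bool using (Bool; true; false)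
open import Data.Sum using (_⊎_; inj₁; inj₂)
open import Data.Product using (Σ; ∃; ∃-syntax; _×_)
open import Data.List using (List; []; _∷_)
open import Relation.Binary.PropositionalEquality using (_≡_; refl)

record Graph (n : ℕ) : Set where
  field
    adj   : Fin n → Fin n → Bool
    sym   : ∀ u v → adj u v ≡ adj v u
    irrfl : ∀ v → adj v v ≡ false
open Graph public

Adj : ∀ {n} → Graph n → Fin n → Fin n → Set
Adj G u v = adj G u v ≡ true

data Walk {n : ℕ} (G : Graph n) : Fin n → Fin n → Set where
  [] : ∀ {u} → Walk G u u
  _∷_ : ∀ {u v w} → Adj G u v → Walk G v w → Walk G u w

Connected : ∀ {n} → Graph n → Set
Connected G = ∀ u v → Walk G u v

Dominating : ∀ {n} → Graph n → Subset n → Set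
Dominating {n} G D = ∀ (v : Fin n) → v ∈ D ⊎ (∃[ u ] (u ∈ D × Adj G u v))

DominationNumber : ∀ {n} → Graph n → ℕ → Set
DominationNumber {n} G k =
  (∃[ D ] (Dominating G D × ∣ D ∣ ≡ k)) × (∀ D → Dominating G D → k ≤ ∣ D ∣)

-- The functigraph C(G,f): vertex set Fin (n + n); the vertices
-- splitAt n x = inj₁ u form the copy G₁, those with inj₂ v form G₂.
-- u ∈ G₁ is joined to v ∈ G₂ exactly when v = f(u).
eqF : ∀ {n} → Fin n → Fin n → Bool
eqF a b = ⌊ a Fin.≟ b ⌋

fgAdj : ∀ {n} → Graph n → (Fin n → Fin n) → Fin (n + n) → Fin (n + n) → Bool
fgAdj {n} G f x y = go (splitAt n x) (splitAt n y)
  where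
  go : Fin n ⊎ Fin n → Fin n ⊎ Fin n → Bool
  go (inj₁ u) (inj₁ v) = adj G u v
  go (inj₂ u) (inj₂ v) = adj G u v
  go (inj₁ u) (inj₂ v) = eqF (f u) v
  go (inj₂ u) (inj₁ v) = eqF (f v) u

functigraph : ∀ {n} → Graph n → (Fin n → Fin n) → Graph (n + n)
functigraph {n} G f = record { adj = fgAdj G f ; sym = s ; irrfl = i }
  where
  s : ∀ x y → fgAdj G f x y ≡ fgAdj G f y x
  s x y with splitAt n x | splitAt n y
  ... | inj₁ u | inj₁ v = Graph.sym G u v
  ... | inj₂ u | inj₂ v = Graph.sym G u v
  ... | inj₁ u | inj₂ v = refl
  ... | inj₂ u | inj₁ v = refl
  i : ∀ x → fgAdj G f x x ≡ false
  i x with splitAt n x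
  ... | inj₁ u = irrfl G u
  ... | inj₂ u = irrfl G u

-- Let G be the clique on a hubs, each hub x carrying two pendant leaves ℓ₁ x and ℓ₂ x.
-- The hubs dominate G, and the a leaves ℓ₁ x have pairwise disjoint closed neighbourhoods,
-- each of which must meet every dominating set; so γ(G) = a.  Write b = a + t with t ≤ a.
-- For the first t indices x, f sends hub x, ℓ₁ x, ℓ₂ x of G₁ to ℓ₂ x of G₂; for the other
-- indices it sends them to hub x of G₂.  The a hubs of G₂ and the first t hubs of G₁
-- dominate C(G,f), while ℓ₁ x in G₂ (nothing is mapped there) and ℓ₁ x in G₁ for the first
-- t indices (its neighbours are hub x and ℓ₂ x) are b vertices with disjoint closed
-- neighbourhoods.
module Submission where

open import Defs hiding (sym)
open import Data.Bool using (Bool; true; false; not)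
open import Data.Fin using (Fin; zero; suc; splitAt)
import Data.Fin as Fin
open import Data.Fin.Patterns using (0F; 1F; 2F)
open import Data.Fin.Properties using (+↔⊎; *↔×; inj⇒≟; injective⇒≤; suc-injective)
open import Data.Fin.Subset using (Subset; _∈_; ∣_∣; inside; outside)
open import Data.Nat using (ℕ; _≤_; _+_; _*_)
open import Data.Nat.Properties using (≤-antisym; ≤-trans; ≤-reflexive; +-cancelˡ-≤; +-identityʳ; m≤n⇒∃[o]m+o≡n)
open import Data.Product using (Σ; ∃-syntax; _×_; _,_; proj₁; proj₂)
open import Data.Product.Function.NonDependent.Propositional using (_×-↔_)
open import Data.Sum using (_⊎_; inj₁; inj₂)
open import Data.Sum.Function.Propositional using (_⊎-↔_)
open import Data.Vec using (_∷_; tabulate)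
open import Data.Vec.Base using (here; there)
open import Data.Vec.Properties using (lookup∘tabulate; []=⇒lookup; lookup⇒[]=)
open import Function.Base using (_∘_)
open import Function.Bundles using (_↔_; Inverse; Injection; mk↔ₛ′)
open import Function.Definitions using (Injective)
open import Function.Properties.Inverse using (↔-refl; ↔-sym; ↔-trans; ↔⇒↣)
open import Relation.Binary.Definitions using (DecidableEquality)
open import Relation.Binary.PropositionalEquality
open import Relation.Nullary.Decidable using (Dec; ⌊_⌋; yes; no)
open import Relation.Nullary.Negation using (contradiction)

open Inverse using (to; from; strictlyInverseˡ; strictlyInverseʳ)

⌊⌋≡true⇒ : ∀ {A : Set} (a? : Dec A) → ⌊ a? ⌋ ≡ true → A
⌊⌋≡true⇒ (yes a) _ = a
⌊⌋≡true⇒ (no _) ()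

⌊≟⌋-refl : ∀ {A : Set} (_≟_ : DecidableEquality A) x → ⌊ x ≟ x ⌋ ≡ true
⌊≟⌋-refl _≟_ x with x ≟ x
... | yes _   = refl
... | no x≢x  = contradiction refl x≢x

⌊≟⌋-sym : ∀ {A : Set} (_≟_ : DecidableEquality A) x y → ⌊ x ≟ y ⌋ ≡ ⌊ y ≟ x ⌋
⌊≟⌋-sym _≟_ x y with x ≟ y | y ≟ x
... | yes _   | yes _   = refl
... | no _    | no _    = refl
... | yes x≡y | no y≢x  = contradiction (sym x≡y) y≢x
... | no x≢y  | yes y≡x = contradiction (sym y≡x) x≢y

rank : ∀ {n} (p : Subset n) {x : Fin n} → x ∈ p → Fin ∣ p ∣
rank (inside  ∷ p) here        = zero
rank (inside  ∷ p) (there x∈p) = suc (rank p x∈p)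
rank (outside ∷ p) (there x∈p) = rank p x∈p

rank-injective : ∀ {n} (p : Subset n) {x y : Fin n} (x∈p : x ∈ p) (y∈p : y ∈ p) →
                 rank p x∈p ≡ rank p y∈p → x ≡ y
rank-injective (inside  ∷ p) here        here        _  = refl
rank-injective (inside  ∷ p) (there x∈p) (there y∈p) eq =
  cong suc (rank-injective p x∈p y∈p (suc-injective eq))
rank-injective (outside ∷ p) (there x∈p) (there y∈p) eq =
  cong suc (rank-injective p x∈p y∈p eq)

select : ∀ {n} (p : Subset n) → Fin ∣ p ∣ → Fin n
select (inside  ∷ p) zero    = zero
select (inside  ∷ p) (suc i) = suc (select p i)
select (outside ∷ p) i       = suc (select p i)

select-∈ : ∀ {n} (p : Subset n) (i : Fin ∣ p ∣) → select p i ∈ p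
select-∈ (inside  ∷ p) zero    = here
select-∈ (inside  ∷ p) (suc i) = there (select-∈ p i)
select-∈ (outside ∷ p) i       = there (select-∈ p i)

select-injective : ∀ {n} (p : Subset n) → Injective _≡_ _≡_ (select p)
select-injective (inside  ∷ p) {zero}  {zero}  _  = refl
select-injective (inside  ∷ p) {suc i} {suc j} eq = cong suc (select-injective p (suc-injective eq))
select-injective (outside ∷ p)                 eq = select-injective p (suc-injective eq)

∣p∣≤-by-labelling : ∀ {n k} (p : Subset n) (label : ∀ {x} → x ∈ p → Fin k) →
                    (∀ {x y} (x∈p : x ∈ p) (y∈p : y ∈ p) → label x∈p ≡ label y∈p → x ≡ y) →
                    ∣ p ∣ ≤ k
∣p∣≤-by-labelling p label label-injective =
  injective⇒≤ λ {i} {j} eq → select-injective p (label-injective (select-∈ p i) (select-∈ p j) eq)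

≤∣p∣-by-injection : ∀ {n k} (p : Subset n) (g : Fin k → Fin n) →
                    (∀ i → g i ∈ p) → Injective _≡_ _≡_ g → k ≤ ∣ p ∣
≤∣p∣-by-injection p g g∈p g-injective =
  injective⇒≤ λ {i} {j} eq → g-injective (rank-injective p (g∈p i) (g∈p j) eq)

module _ {N : ℕ} {G : Graph N} where

  _++ᵂ_ : ∀ {u v w} → Walk G u v → Walk G v w → Walk G u w
  []       ++ᵂ q = q
  (e ∷ p) ++ᵂ q = e ∷ (p ++ᵂ q)

  reverseᵂ : ∀ {u v} → Walk G u v → Walk G v u
  reverseᵂ []                = []
  reverseᵂ (_∷_ {u} {v} e p) = reverseᵂ p ++ᵂ (trans (Graph.sym G v u) e ∷ [])

-- Centres with pairwise disjoint closed neighbourhoods, the disjointness witnessed by owner.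
record Packing {V : Set} (_~_ : V → V → Bool) (I : Set) : Set where
  field
    centre         : I → V
    owner          : V → I
    owner-centre   : ∀ i → owner (centre i) ≡ i
    owner-adjacent : ∀ {i w} → w ~ centre i ≡ true → owner w ≡ i

reindex : ∀ {V : Set} {_~_ : V → V → Bool} {I J : Set} → I ↔ J → Packing _~_ I → Packing _~_ J
reindex ι P = record
  { centre         = centre ∘ from ι
  ; owner          = to ι ∘ owner
  ; owner-centre   = λ j → trans (cong (to ι) (owner-centre (from ι j))) (strictlyInverseˡ ι j)
  ; owner-adjacent = λ w~c → trans (cong (to ι) (owner-adjacent w~c)) (strictlyInverseˡ ι _)
  }
  where open Packing P

module _ {N : ℕ} (H : Graph N) where

  packing≤∣dominating∣ : ∀ {k D} → Packing (adj H) (Fin k) → Dominating H D → k ≤ ∣ D ∣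
  packing≤∣dominating∣ {D = D} P D-dom =
    ≤∣p∣-by-injection D (proj₁ ∘ dominator) (proj₁ ∘ proj₂ ∘ dominator) dominator-injective
    where
    open Packing P
    dominator : ∀ i → Σ (Fin N) λ w → w ∈ D × owner w ≡ i
    dominator i with D-dom (centre i)
    ... | inj₁ c∈D             = centre i , c∈D , owner-centre i
    ... | inj₂ (w , w∈D , w~c) = w , w∈D , owner-adjacent w~c
    dominator-injective : Injective _≡_ _≡_ (proj₁ ∘ dominator)
    dominator-injective {i} {j} eq = begin
      i                            ≡⟨ proj₂ (proj₂ (dominator i)) ⟨
      owner (proj₁ (dominator i))  ≡⟨ cong owner eq ⟩
      owner (proj₁ (dominator j))  ≡⟨ proj₂ (proj₂ (dominator j)) ⟩
      j                            ∎
      where open ≡-Reasoning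

  dominationNumber-by-packing : ∀ {k D} → Dominating H D → ∣ D ∣ ≤ k →
                                Packing (adj H) (Fin k) → DominationNumber H k
  dominationNumber-by-packing D-dom ∣D∣≤k P =
    (_ , D-dom , ≤-antisym ∣D∣≤k (packing≤∣dominating∣ P D-dom)) , λ _ → packing≤∣dominating∣ P

Dominates : ∀ {V : Set} → (V → V → Bool) → (V → Bool) → Set
Dominates _~_ chosen = ∀ v → chosen v ≡ true ⊎ ∃[ u ] (chosen u ≡ true × u ~ v ≡ true)

-- The labelling bounds the size of the dominating set by the cardinality of I.
record LabelledDominatingSet {V : Set} (_~_ : V → V → Bool) (I : Set) : Set where
  field
    chosen          : V → Bool
    dominates       : Dominates _~_ chosen
    label           : ∀ {v} → chosen v ≡ true → I
    label-injective : ∀ {u v} (cu : chosen u ≡ true) (cv : chosen v ≡ true) →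
                      label cu ≡ label cv → u ≡ v

graphOn : ∀ {N} {V : Set} → V ↔ Fin N → (_~_ : V → V → Bool) →
          (∀ u v → u ~ v ≡ v ~ u) → (∀ v → v ~ v ≡ false) → Graph N
graphOn ι _~_ ~-sym ~-irrefl = record
  { adj   = λ x y → from ι x ~ from ι y
  ; sym   = λ x y → ~-sym (from ι x) (from ι y)
  ; irrfl = λ x → ~-irrefl (from ι x)
  }

module Presented {N : ℕ} {V : Set} (ι : V ↔ Fin N) (_~_ : V → V → Bool) (H : Graph N)
                 (adj≡ : ∀ x y → adj H x y ≡ from ι x ~ from ι y) where

  edge : ∀ {u v} → u ~ v ≡ true → Adj H (to ι u) (to ι v)
  edge {u} {v} u~v =
    trans (adj≡ _ _) (trans (cong₂ _~_ (strictlyInverseʳ ι u) (strictlyInverseʳ ι v)) u~v)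

  lift-packing : ∀ {I} → Packing _~_ I → Packing (adj H) I
  lift-packing P = record
    { centre         = to ι ∘ centre
    ; owner          = owner ∘ from ι
    ; owner-centre   = λ i → trans (cong owner (strictlyInverseʳ ι (centre i))) (owner-centre i)
    ; owner-adjacent = λ {i} {w} w~c → owner-adjacent
        (subst (λ c → from ι w ~ c ≡ true) (strictlyInverseʳ ι (centre i)) (trans (sym (adj≡ _ _)) w~c))
    }
    where open Packing P

  subset : (V → Bool) → Subset N
  subset chosen = tabulate (chosen ∘ from ι)

  ∈-subset⁺ : ∀ chosen {v} → chosen v ≡ true → to ι v ∈ subset chosen
  ∈-subset⁺ chosen {v} cv = lookup⇒[]= (to ι v) (subset chosen)
    (trans (lookup∘tabulate (chosen ∘ from ι) (to ι v)) (trans (cong chosen (strictlyInverseʳ ι v)) cv))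

  ∈-subset⁻ : ∀ chosen {x} → x ∈ subset chosen → chosen (from ι x) ≡ true
  ∈-subset⁻ chosen {x} x∈ = trans (sym (lookup∘tabulate (chosen ∘ from ι) x)) ([]=⇒lookup x∈)

  lift-dominating : ∀ {chosen} → Dominates _~_ chosen → Dominating H (subset chosen)
  lift-dominating {chosen} dom x with dom (from ι x)
  ... | inj₁ cx = inj₁ (subst (_∈ subset chosen) (strictlyInverseˡ ι x) (∈-subset⁺ chosen cx))
  ... | inj₂ (u , cu , u~x) = inj₂ (to ι u , ∈-subset⁺ chosen cu ,
          subst (λ y → Adj H (to ι u) y) (strictlyInverseˡ ι x) (edge u~x))

  dominationNumber : ∀ {I k} → I ↔ Fin k → LabelledDominatingSet _~_ I → Packing _~_ I →
                     DominationNumber H k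
  dominationNumber {k = k} I↔ D P =
    dominationNumber-by-packing H (lift-dominating dominates) ∣D∣≤k (lift-packing (reindex I↔ P))
    where
    open LabelledDominatingSet D
    ∣D∣≤k : ∣ subset chosen ∣ ≤ k
    ∣D∣≤k = ∣p∣≤-by-labelling (subset chosen) (to I↔ ∘ label ∘ ∈-subset⁻ chosen)
      λ _ _ eq → Injection.injective (↔⇒↣ (↔-sym ι))
                   (label-injective _ _ (Injection.injective (↔⇒↣ I↔) eq))

module Functigraph {N : ℕ} {V : Set} (ι : V ↔ Fin N) (_~_ : V → V → Bool) (G : Graph N)
                   (adj≡ : ∀ x y → adj G x y ≡ from ι x ~ from ι y) (φ : V → V) where

  -- Tested on indices, so that the edges between the copies agree with eqF definitionally.
  _==_ : V → V → Bool
  u == v = eqF (to ι u) (to ι v)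

  ==-refl : ∀ v → v == v ≡ true
  ==-refl v = ⌊≟⌋-refl Fin._≟_ (to ι v)

  ==⇒≡ : ∀ u v → u == v ≡ true → u ≡ v
  ==⇒≡ u v eq = Injection.injective (↔⇒↣ ι) (⌊⌋≡true⇒ (to ι u Fin.≟ to ι v) eq)

  _~ᶠ_ : V ⊎ V → V ⊎ V → Bool
  inj₁ u ~ᶠ inj₁ v = u ~ v
  inj₂ u ~ᶠ inj₂ v = u ~ v
  inj₁ u ~ᶠ inj₂ v = φ u == v
  inj₂ u ~ᶠ inj₁ v = φ v == u

  copies : (V ⊎ V) ↔ Fin (N + N)
  copies = ↔-trans (ι ⊎-↔ ι) (↔-sym +↔⊎)

  f : Fin N → Fin N
  f = to ι ∘ φ ∘ from ι

  adj≡ᶠ : ∀ x y → adj (functigraph G f) x y ≡ from copies x ~ᶠ from copies y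
  adj≡ᶠ x y with splitAt N x | splitAt N y
  ... | inj₁ u | inj₁ v = adj≡ u v
  ... | inj₂ u | inj₂ v = adj≡ u v
  ... | inj₁ u | inj₂ v = cong (eqF (f u)) (sym (strictlyInverseˡ ι v))
  ... | inj₂ u | inj₁ v = cong (eqF (f v)) (sym (strictlyInverseˡ ι u))

  open Presented copies _~ᶠ_ (functigraph G f) adj≡ᶠ public

data Kind : Set where
  hub leaf₁ leaf₂ : Kind

Kind↔Fin3 : Kind ↔ Fin 3
Kind↔Fin3 = mk↔ₛ′ (λ { hub → 0F ; leaf₁ → 1F ; leaf₂ → 2F })
                  (λ { 0F → hub ; 1F → leaf₁ ; 2F → leaf₂ })
                  (λ { 0F → refl ; 1F → refl ; 2F → refl })
                  (λ { hub → refl ; leaf₁ → refl ; leaf₂ → refl })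

module Corona {m : ℕ} {X : Set} (X↔ : X ↔ Fin m) where

  _≟ₓ_ : DecidableEquality X
  _≟ₓ_ = inj⇒≟ (↔⇒↣ X↔)

  Vertex : Set
  Vertex = Kind × X

  vertices : Vertex ↔ Fin (3 * m)
  vertices = ↔-trans (Kind↔Fin3 ×-↔ X↔) (↔-sym *↔×)

  _~_ : Vertex → Vertex → Bool
  (hub   , x) ~ (hub   , y) = not ⌊ x ≟ₓ y ⌋
  (hub   , x) ~ (leaf₁ , y) = ⌊ x ≟ₓ y ⌋
  (hub   , x) ~ (leaf₂ , y) = ⌊ x ≟ₓ y ⌋
  (leaf₁ , x) ~ (hub   , y) = ⌊ y ≟ₓ x ⌋
  (leaf₂ , x) ~ (hub   , y) = ⌊ y ≟ₓ x ⌋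
  (leaf₁ , _) ~ (leaf₁ , _) = false
  (leaf₁ , _) ~ (leaf₂ , _) = false
  (leaf₂ , _) ~ (leaf₁ , _) = false
  (leaf₂ , _) ~ (leaf₂ , _) = false

  ~-sym : ∀ u v → u ~ v ≡ v ~ u
  ~-sym (hub   , x) (hub   , y) = cong not (⌊≟⌋-sym _≟ₓ_ x y)
  ~-sym (hub   , _) (leaf₁ , _) = refl
  ~-sym (hub   , _) (leaf₂ , _) = refl
  ~-sym (leaf₁ , _) (hub   , _) = refl
  ~-sym (leaf₂ , _) (hub   , _) = refl
  ~-sym (leaf₁ , _) (leaf₁ , _) = refl
  ~-sym (leaf₁ , _) (leaf₂ , _) = refl
  ~-sym (leaf₂ , _) (leaf₁ , _) = refl
  ~-sym (leaf₂ , _) (leaf₂ , _) = refl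

  ~-irrefl : ∀ v → v ~ v ≡ false
  ~-irrefl (hub   , x) = cong not (⌊≟⌋-refl _≟ₓ_ x)
  ~-irrefl (leaf₁ , _) = refl
  ~-irrefl (leaf₂ , _) = refl

  G : Graph (3 * m)
  G = graphOn vertices _~_ ~-sym ~-irrefl

  open Presented vertices _~_ G (λ _ _ → refl)

  toHub : ∀ v → Walk G (to vertices v) (to vertices (hub , proj₂ v))
  toHub (hub   , x) = []
  toHub (leaf₁ , x) = edge {leaf₁ , x} {hub , x} (⌊≟⌋-refl _≟ₓ_ x) ∷ []
  toHub (leaf₂ , x) = edge {leaf₂ , x} {hub , x} (⌊≟⌋-refl _≟ₓ_ x) ∷ []

  betweenHubs : ∀ x y → Walk G (to vertices (hub , x)) (to vertices (hub , y))
  betweenHubs x y with x ≟ₓ y in x≟y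
  ... | yes refl = []
  ... | no _     = edge {hub , x} {hub , y} (cong (not ∘ ⌊_⌋) x≟y) ∷ []

  connected : Connected G
  connected x y = subst₂ (Walk G) (strictlyInverseˡ vertices x) (strictlyInverseˡ vertices y)
    (toHub u ++ᵂ (betweenHubs (proj₂ u) (proj₂ v) ++ᵂ reverseᵂ (toHub v)))
    where
    u v : Vertex
    u = from vertices x
    v = from vertices y

  hubs : LabelledDominatingSet _~_ X
  hubs = record
    { chosen          = λ { (hub , _) → true ; (leaf₁ , _) → false ; (leaf₂ , _) → false }
    ; dominates       = λ { (hub , x)   → inj₁ refl
                          ; (leaf₁ , x) → inj₂ ((hub , x) , refl , ⌊≟⌋-refl _≟ₓ_ x)
                          ; (leaf₂ , x) → inj₂ ((hub , x) , refl , ⌊≟⌋-refl _≟ₓ_ x) }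
    ; label           = λ { {hub , x} _ → x }
    ; label-injective = λ { {hub , _} {hub , _} _ _ refl → refl }
    }

  leaves : Packing _~_ X
  leaves = record
    { centre         = leaf₁ ,_
    ; owner          = proj₂
    ; owner-centre   = λ _ → refl
    ; owner-adjacent = λ { {x} {hub , y} y~x → ⌊⌋≡true⇒ (y ≟ₓ x) y~x }
    }

  γ : DominationNumber G m
  γ = dominationNumber X↔ hubs leaves

module CoronaFunctigraph (t s : ℕ) where

  open Corona (↔-sym (+↔⊎ {t} {s})) public

  φ : Vertex → Vertex
  φ (_ , inj₁ j) = leaf₂ , inj₁ j
  φ (_ , inj₂ j) = hub   , inj₂ j

  φ≢leaf₁ : ∀ u x → φ u ≢ (leaf₁ , x)
  φ≢leaf₁ (_ , inj₁ _) _ ()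
  φ≢leaf₁ (_ , inj₂ _) _ ()

  open Functigraph vertices _~_ G (λ _ _ → refl) φ public

  Index : Set
  Index = (Fin t ⊎ Fin s) ⊎ Fin t

  Index↔ : Index ↔ Fin ((t + s) + t)
  Index↔ = ↔-trans (↔-sym +↔⊎ ⊎-↔ ↔-refl) (↔-sym +↔⊎)

  chosen : Vertex ⊎ Vertex → Bool
  chosen (inj₂ (hub , _))      = true
  chosen (inj₁ (hub , inj₁ _)) = true
  chosen _                     = false

  label : ∀ {v} → chosen v ≡ true → Index
  label {inj₂ (hub , x)}      _ = inj₁ x
  label {inj₁ (hub , inj₁ j)} _ = inj₂ j

  dominatingSet : LabelledDominatingSet _~ᶠ_ (Index)
  dominatingSet = record
    { chosen          = chosen
    ; dominates       = dominates
    ; label           = label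
    ; label-injective = label-injective
    }
    where
    dominates : Dominates _~ᶠ_ chosen
    dominates (inj₂ (hub   , x))      = inj₁ refl
    dominates (inj₂ (leaf₁ , x))      = inj₂ (inj₂ (hub , x) , refl , ⌊≟⌋-refl _≟ₓ_ x)
    dominates (inj₂ (leaf₂ , x))      = inj₂ (inj₂ (hub , x) , refl , ⌊≟⌋-refl _≟ₓ_ x)
    dominates (inj₁ (hub   , inj₁ j)) = inj₁ refl
    dominates (inj₁ (leaf₁ , inj₁ j)) = inj₂ (inj₁ (hub , inj₁ j) , refl , ⌊≟⌋-refl _≟ₓ_ (inj₁ j))
    dominates (inj₁ (leaf₂ , inj₁ j)) = inj₂ (inj₁ (hub , inj₁ j) , refl , ⌊≟⌋-refl _≟ₓ_ (inj₁ j))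
    dominates (inj₁ (_     , inj₂ j)) = inj₂ (inj₂ (hub , inj₂ j) , refl , ==-refl (hub , inj₂ j))
    label-injective : ∀ {u v} (cu : chosen u ≡ true) (cv : chosen v ≡ true) →
                      label cu ≡ label cv → u ≡ v
    label-injective {inj₂ (hub , _)}      {inj₂ (hub , _)}      _ _ refl = refl
    label-injective {inj₁ (hub , inj₁ _)} {inj₁ (hub , inj₁ _)} _ _ refl = refl
    label-injective {inj₂ (hub , _)}      {inj₁ (hub , inj₁ _)} _ _ ()
    label-injective {inj₁ (hub , inj₁ _)} {inj₂ (hub , _)}      _ _ ()

  centre : Index → Vertex ⊎ Vertex
  centre (inj₁ x) = inj₂ (leaf₁ , x)
  centre (inj₂ j) = inj₁ (leaf₁ , inj₁ j)

  -- Vertices lying in no closed neighbourhood of a centre are owned arbitrarily.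
  owner : Vertex ⊎ Vertex → Index
  owner (inj₂ (leaf₂ , inj₁ j)) = inj₂ j
  owner (inj₂ (_     , x))      = inj₁ x
  owner (inj₁ (_     , inj₁ j)) = inj₂ j
  owner (inj₁ (_     , inj₂ j)) = inj₁ (inj₂ j)

  owner-adjacent : ∀ {i w} → w ~ᶠ centre i ≡ true → owner w ≡ i
  owner-adjacent {inj₁ x} {inj₂ (hub , y)} w~c = cong inj₁ (⌊⌋≡true⇒ (y ≟ₓ x) w~c)
  owner-adjacent {inj₁ x} {inj₁ u}         w~c =
    contradiction (==⇒≡ (φ u) (leaf₁ , x) w~c) (φ≢leaf₁ u x)
  owner-adjacent {inj₂ j} {inj₁ (hub , y)} w~c =
    cong (λ y → owner (inj₁ (hub , y))) (⌊⌋≡true⇒ (y ≟ₓ inj₁ j) w~c)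
  owner-adjacent {inj₂ j} {inj₂ w}         w~c =
    cong (owner ∘ inj₂) (sym (==⇒≡ (leaf₂ , inj₁ j) w w~c))

  packing : Packing _~ᶠ_ (Index)
  packing = record
    { centre         = centre
    ; owner          = owner
    ; owner-centre   = λ { (inj₁ _) → refl ; (inj₂ _) → refl }
    ; owner-adjacent = owner-adjacent
    }

  γᶠ : DominationNumber (functigraph G f) ((t + s) + t)
  γᶠ = dominationNumber Index↔ dominatingSet packing

between-a-and-2a : ∀ {a b} → a ≤ b → b ≤ 2 * a → ∃[ t ] ∃[ s ] (t + s ≡ a × a + t ≡ b)
between-a-and-2a {a} a≤b b≤2a with m≤n⇒∃[o]m+o≡n a≤b
... | t , refl
    with m≤n⇒∃[o]m+o≡n (≤-trans (+-cancelˡ-≤ a t (a + 0) b≤2a) (≤-reflexive (+-identityʳ a)))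
... | s , t+s≡a = t , s , t+s≡a , refl

-- The construction also works for a = 0 (the empty graph).
theorem2p2 : ∀ (a b : ℕ) → 1 ≤ a → a ≤ b → b ≤ 2 * a →
    ∃[ n ] Σ (Graph n) λ G → Connected G × DominationNumber G a ×
      ∃[ f ] DominationNumber (functigraph G f) b
theorem2p2 a b _ a≤b b≤2a with between-a-and-2a a≤b b≤2a
... | t , s , refl , refl = _ , G , connected , γ , f , γᶠ
  where open CoronaFunctigraph t s
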